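{- Let $n\geq 3$ and $\pi=\pi_1\cdots\pi_n\in\mathcal{S}_n$. Then [$\pi$ avoids both $231$ and $1432$, $\pi^2$ avoids $231$, and $\pi_{n-1}=n$, $\pi_n=n-1$] if and only if $\pi=\sigma\oplus 21$ for some $\sigma\in\mathcal{S}_{n-2}$ such that $\sigma$ avoids both $231$ and $1432$ and $\sigma^2$ avoids $231$.
   Context: $\mathcal{S}_n$ is the set of permutations of $[n]$, written as words with $\pi_i=\pi(i)$; $\pi^2=\pi\circ\pi$. A permutation contains a pattern $\sigma\in\mathcal{S}_k$ if some (not necessarily consecutive) subsequence of length $k$ is order isomorphic to $\sigma$; otherwise it avoids it. For $\sigma\in\mathcal{S}_k$, $\tau\in\mathcal{S}_m$, the direct sum $\sigma\oplus\tau\in\mathcal{S}_{k+m}$ is defined by $(\sigma\oplus\tau)(i)=\sigma(i)$ for $1\le i\le k$ and $(\sigma\oplus\tau)(i)=\tau(i-k)+k$ for $k+1\le i\le k+m$; here $21\in\mathcal{S}_2$. -}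

module Defs where

open import Data.Nat.Base using (ℕ; zero; suc; _+_)
open import Data.Fin.Base using (Fin; zero; suc; _<_; splitAt; join)
open import Data.Fin.Permutation using (Permutation′; _⟨$⟩ʳ_)
open import Data.Sum.Base using (_⊎_; inj₁; inj₂; [_,_]′)
open import Data.Product.Base using (Σ; _×_)
open import Function.Base using (_∘_)
open import Function.Construct.Composition using (_↔-∘_)
open import Relation.Nullary.Negation using (¬_)

-- A permutation of [n] is a bijection Fin n ↔ Fin n; its one-line word
-- is i ↦ π(i), with values 0-indexed (Fin n), order = the order on Fin n.

OccursIn : ∀ {k n} → (Fin k → Fin k) → (Fin n → Fin n) → Set
OccursIn {k} {n} σ f =
  Σ (Fin k → Fin n) λ p →
    (∀ i j → i < j → p i < p j) ×
    (∀ i j → (f (p i) < f (p j) → σ i < σ j) × (σ i < σ j → f (p i) < f (p j)))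

Contains : ∀ {k n} → (Fin k → Fin k) → Permutation′ n → Set
Contains σ π = OccursIn σ (π ⟨$⟩ʳ_)

Avoids : ∀ {k n} → (Fin k → Fin k) → Permutation′ n → Set
Avoids σ π = ¬ Contains σ π

square : ∀ {n} → Permutation′ n → Permutation′ n
square π = π ↔-∘ π

p231 : Fin 3 → Fin 3
p231 zero = suc zero
p231 (suc zero) = suc (suc zero)
p231 (suc (suc zero)) = zero

p1432 : Fin 4 → Fin 4
p1432 zero = zero
p1432 (suc zero) = suc (suc (suc zero))
p1432 (suc (suc zero)) = suc (suc zero)
p1432 (suc (suc (suc zero))) = suc zero

p21 : Fin 2 → Fin 2
p21 zero = suc zero
p21 (suc zero) = zero

-- direct sum of words: (σ ⊕ τ)(i) = σ(i) for i < k, τ(i-k)+k otherwise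
_⊕_ : ∀ {k m} → (Fin k → Fin k) → (Fin m → Fin m) → Fin (k + m) → Fin (k + m)
_⊕_ {k} {m} σ τ i = join k m ([ (λ a → inj₁ (σ a)) , (λ b → inj₂ (τ b)) ]′ (splitAt k i))

-- A permutation fixing the block {n-1, n} setwise maps [n-2] onto itself, so
-- π = σ ⊕ 21 with σ its restriction; and π² = σ² ⊕ 12. Occurrences of a pattern
-- in σ (or σ²) are occurrences in π (or π²) inside the first block. Conversely,
-- in 231 and 1432 the last letter has two larger letters, whereas a letter of π
-- or π² at position n-1 or n is at least n-1, so nothing can be two steps above
-- it; hence every occurrence in π (or π²) lies inside the first block.
module Submission where

open import Defs
open import Data.Nat.Base as ℕ using (ℕ; suc; _+_; _≤_; z≤n; s≤s)
import Data.Nat.Properties as ℕ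
open import Data.Fin.Base using (Fin; zero; suc; toℕ; fromℕ; fromℕ<; splitAt; _↑ˡ_; _↑ʳ_; _<_)
open import Data.Fin.Properties
  using (toℕ-↑ˡ; toℕ-↑ʳ; toℕ<n; ≤fromℕ; splitAt-↑ˡ; splitAt-↑ʳ; splitAt⁻¹-↑ˡ; splitAt⁻¹-↑ʳ; splitAt-<; ↑ˡ-injective; toℕ-injective)
open import Data.Fin.Permutation using (Permutation′; _⟨$⟩ʳ_; _⟨$⟩ˡ_; inverseˡ; inverseʳ; permutation)
open import Data.Product.Base using (Σ; ∃; ∃₂; _×_; _,_; proj₁; proj₂)
open import Data.Sum.Base using (_⊎_; inj₁; inj₂)
open import Data.Empty using (⊥-elim)
open import Function.Base using (_∘_)
open import Function.Bundles using (_⇔_; mk⇔; Equivalence; Injection)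
open import Function.Properties.Inverse using (↔⇒↣)
import Function.Properties.Equivalence as ⇔
open import Relation.Binary.PropositionalEquality
  using (_≡_; _≢_; refl; sym; trans; cong; subst; subst₂; module ≡-Reasoning)
open import Relation.Nullary using (¬_)

open Equivalence using (to; from)

private
  variable
    k m n s : ℕ

↑ˡ⊎↑ʳ : ∀ k {m} (i : Fin (k + m)) → (∃ λ a → a ↑ˡ m ≡ i) ⊎ (∃ λ b → k ↑ʳ b ≡ i)
↑ˡ⊎↑ʳ k i with splitAt k i in eq
... | inj₁ a = inj₁ (a , splitAt⁻¹-↑ˡ eq)
... | inj₂ b = inj₂ (b , splitAt⁻¹-↑ʳ eq)

↑ˡ≢↑ʳ : (a : Fin k) (b : Fin m) → a ↑ˡ m ≢ k ↑ʳ b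
↑ˡ≢↑ʳ {k} {m} a b eq with trans (sym (splitAt-↑ˡ k a m)) (trans (cong (splitAt k) eq) (splitAt-↑ʳ k m b))
... | ()

↑ˡ-<⇔ : ∀ m {a b : Fin k} → a < b ⇔ a ↑ˡ m < b ↑ˡ m
↑ˡ-<⇔ m {a} {b} = mk⇔
  (subst₂ ℕ._<_ (sym (toℕ-↑ˡ a m)) (sym (toℕ-↑ˡ b m)))
  (subst₂ ℕ._<_ (toℕ-↑ˡ a m) (toℕ-↑ˡ b m))

record IsDirectSum (f : Fin (k + m) → Fin (k + m)) (g : Fin k → Fin k) (h : Fin m → Fin m) : Set where
  constructor _,_
  field
    on-left  : ∀ a → f (a ↑ˡ m) ≡ g a ↑ˡ m
    on-right : ∀ b → f (k ↑ʳ b) ≡ k ↑ʳ h b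

open IsDirectSum

⊕-↑ˡ : (g : Fin k → Fin k) (h : Fin m → Fin m) (a : Fin k) → (g ⊕ h) (a ↑ˡ m) ≡ g a ↑ˡ m
⊕-↑ˡ {k} {m} g h a rewrite splitAt-↑ˡ k a m = refl

⊕-↑ʳ : (g : Fin k → Fin k) (h : Fin m → Fin m) (b : Fin m) → (g ⊕ h) (k ↑ʳ b) ≡ k ↑ʳ h b
⊕-↑ʳ {k} {m} g h b rewrite splitAt-↑ʳ k m b = refl

≗⊕⇔isDirectSum : {f : Fin (k + m) → Fin (k + m)} {g : Fin k → Fin k} {h : Fin m → Fin m} →
  (∀ i → f i ≡ (g ⊕ h) i) ⇔ IsDirectSum f g h
≗⊕⇔isDirectSum {k} {f = f} {g} {h} = mk⇔
  (λ f≗ → (λ a → trans (f≗ _) (⊕-↑ˡ g h a)) , (λ b → trans (f≗ _) (⊕-↑ʳ g h b)))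
  from-blocks
  where
  from-blocks : IsDirectSum f g h → ∀ i → f i ≡ (g ⊕ h) i
  from-blocks (f-left , f-right) i with ↑ˡ⊎↑ʳ k i
  ... | inj₁ (a , refl) = trans (f-left a) (sym (⊕-↑ˡ g h a))
  ... | inj₂ (b , refl) = trans (f-right b) (sym (⊕-↑ʳ g h b))

isDirectSum-∘ : {f f′ : Fin (k + m) → Fin (k + m)} {g g′ : Fin k → Fin k} {h h′ : Fin m → Fin m} →
  IsDirectSum f g h → IsDirectSum f′ g′ h′ → IsDirectSum (f ∘ f′) (g ∘ g′) (h ∘ h′)
isDirectSum-∘ {f = f} (f-left , f-right) (f′-left , f′-right) =
  (λ a → trans (cong f (f′-left a)) (f-left _)) , (λ b → trans (cong f (f′-right b)) (f-right _))

restrictˡ : (π : Permutation′ (k + m)) (h : Fin m → Fin m) → (∀ b → ∃ λ c → h c ≡ b) →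
  (∀ b → π ⟨$⟩ʳ (k ↑ʳ b) ≡ k ↑ʳ h b) →
  Σ (Permutation′ k) λ σ → IsDirectSum (π ⟨$⟩ʳ_) (σ ⟨$⟩ʳ_) h
restrictˡ {k} {m} π h h-onto π-right = σ , (λ a → proj₂ (image a)) , π-right
  where
  π-injective : ∀ {x y} → π ⟨$⟩ʳ x ≡ π ⟨$⟩ʳ y → x ≡ y
  π-injective = Injection.injective (↔⇒↣ π)

  in-left-block : (x : Fin (k + m)) → (∀ b → x ≢ k ↑ʳ b) → ∃ λ a → x ≡ a ↑ˡ m
  in-left-block x x∉right with ↑ˡ⊎↑ʳ k x
  ... | inj₁ (a , refl) = a , refl
  ... | inj₂ (b , refl) = ⊥-elim (x∉right b refl)

  image : ∀ a → ∃ λ a′ → π ⟨$⟩ʳ (a ↑ˡ m) ≡ a′ ↑ˡ m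
  image a = in-left-block _ λ b πa≡b → let (c , hc≡b) = h-onto b in
    ↑ˡ≢↑ʳ a c (π-injective (trans πa≡b (trans (cong (k ↑ʳ_) (sym hc≡b)) (sym (π-right c)))))

  preimage : ∀ a → ∃ λ a′ → π ⟨$⟩ˡ (a ↑ˡ m) ≡ a′ ↑ˡ m
  preimage a = in-left-block _ λ b π⁻¹a≡b →
    ↑ˡ≢↑ʳ a (h b) (trans (sym (inverseʳ π)) (trans (cong (π ⟨$⟩ʳ_) π⁻¹a≡b) (π-right b)))

  σ : Permutation′ k
  σ = permutation (proj₁ ∘ image) (proj₁ ∘ preimage) (λ a → ↑ˡ-injective m _ _ (begin
      proj₁ (image (proj₁ (preimage a))) ↑ˡ m ≡⟨ sym (proj₂ (image _)) ⟩
      π ⟨$⟩ʳ (proj₁ (preimage a) ↑ˡ m)        ≡⟨ cong (π ⟨$⟩ʳ_) (sym (proj₂ (preimage a))) ⟩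
      π ⟨$⟩ʳ (π ⟨$⟩ˡ (a ↑ˡ m))                ≡⟨ inverseʳ π ⟩
      a ↑ˡ m                                   ∎))
    (λ a → ↑ˡ-injective m _ _ (begin
      proj₁ (preimage (proj₁ (image a))) ↑ˡ m ≡⟨ sym (proj₂ (preimage _)) ⟩
      π ⟨$⟩ˡ (proj₁ (image a) ↑ˡ m)           ≡⟨ cong (π ⟨$⟩ˡ_) (sym (proj₂ (image a))) ⟩
      π ⟨$⟩ˡ (π ⟨$⟩ʳ (a ↑ˡ m))                ≡⟨ inverseˡ π ⟩
      a ↑ˡ m                                   ∎))
    where open ≡-Reasoning

-- The body of OccursIn, so that OccursIn σ f is Σ _ (IsOccurrence σ f) by definition.
IsOccurrence : (Fin s → Fin s) → (Fin n → Fin n) → (Fin s → Fin n) → Set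
IsOccurrence σ f p =
  (∀ i j → i < j → p i < p j) ×
  (∀ i j → (f (p i) < f (p j) → σ i < σ j) × (σ i < σ j → f (p i) < f (p j)))

isOccurrence-⇔ : {σ : Fin s → Fin s} {f : Fin n → Fin n} {g : Fin k → Fin k} {p : Fin s → Fin n} {q : Fin s → Fin k} →
  (∀ i j → p i < p j ⇔ q i < q j) → (∀ i j → f (p i) < f (p j) ⇔ g (q i) < g (q j)) →
  IsOccurrence σ f p ⇔ IsOccurrence σ g q
isOccurrence-⇔ {f = f} {g} positions values = mk⇔ (transfer {f = f} {g} positions values)
  (transfer {f = g} {f} (λ i j → ⇔.sym (positions i j)) (λ i j → ⇔.sym (values i j)))
  where
  transfer : ∀ {n k} {σ : Fin s → Fin s} {f : Fin n → Fin n} {g : Fin k → Fin k} {p q} →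
    (∀ i j → p i < p j ⇔ q i < q j) → (∀ i j → f (p i) < f (p j) ⇔ g (q i) < g (q j)) →
    IsOccurrence σ f p → IsOccurrence σ g q
  transfer positions values (increasing , order) =
    (λ i j → to (positions i j) ∘ increasing i j) ,
    (λ i j → (proj₁ (order i j) ∘ from (values i j)) , (to (values i j) ∘ proj₂ (order i j)))

module _ {f : Fin n → Fin n} {g : Fin k → Fin k} (e : Fin k → Fin n)
         (e-<⇔ : ∀ {a b} → a < b ⇔ e a < e b) (f∘e≗e∘g : ∀ a → f (e a) ≡ e (g a)) where

  isOccurrence-transfer : {σ : Fin s → Fin s} {p : Fin s → Fin n} {q : Fin s → Fin k} →
    (∀ i → p i ≡ e (q i)) → IsOccurrence σ f p ⇔ IsOccurrence σ g q
  isOccurrence-transfer {p = p} {q} p≗e∘q = isOccurrence-⇔ {f = f} {g} positions values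
    where
    positions : ∀ i j → p i < p j ⇔ q i < q j
    positions i j rewrite p≗e∘q i | p≗e∘q j = ⇔.sym e-<⇔
    values : ∀ i j → f (p i) < f (p j) ⇔ g (q i) < g (q j)
    values i j rewrite p≗e∘q i | p≗e∘q j | f∘e≗e∘g (q i) | f∘e≗e∘g (q j) = ⇔.sym e-<⇔

occursIn-extension : {σ : Fin s → Fin s} {f : Fin (k + m) → Fin (k + m)} {g : Fin k → Fin k} {h : Fin m → Fin m} →
  IsDirectSum f g h → OccursIn σ g → OccursIn σ f
occursIn-extension {m = m} {f = f} {g} (f-left , _) (q , occ) =
  (_↑ˡ m) ∘ q , from (isOccurrence-transfer {f = f} {g} (_↑ˡ m) (↑ˡ-<⇔ m) f-left λ _ → refl) occ

LastUnderTwo : (Fin (suc s) → Fin (suc s)) → Set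
LastUnderTwo {s} σ = ∃₂ λ a b → σ (fromℕ s) < σ a × σ a < σ b

p231-lastUnderTwo : LastUnderTwo p231
p231-lastUnderTwo = zero , suc zero , s≤s z≤n , s≤s (s≤s z≤n)

p1432-lastUnderTwo : LastUnderTwo p1432
p1432-lastUnderTwo = suc (suc zero) , suc zero , s≤s (s≤s z≤n) , s≤s (s≤s (s≤s z≤n))

k≤x<y⇒y≮z : {x y z : Fin (k + 2)} → k ≤ toℕ x → x < y → ¬ y < z
k≤x<y⇒y≮z {k} {x} {y} {z} k≤x x<y y<z = ℕ.<-irrefl refl (begin-strict
  k + 2             ≡⟨ ℕ.+-comm k 2 ⟩
  2 + k             ≤⟨ s≤s (s≤s k≤x) ⟩
  suc (suc (toℕ x)) ≤⟨ s≤s x<y ⟩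
  suc (toℕ y)       ≤⟨ y<z ⟩
  toℕ z             <⟨ toℕ<n z ⟩
  k + 2             ∎)
  where open ℕ.≤-Reasoning

increasing⇒monotone : {p : Fin s → Fin n} → (∀ i j → i < j → p i < p j) →
  ∀ {i j} → toℕ i ≤ toℕ j → toℕ (p i) ≤ toℕ (p j)
increasing⇒monotone {p = p} increasing {i} {j} i≤j with ℕ.m≤n⇒m<n∨m≡n i≤j
... | inj₁ i<j = ℕ.<⇒≤ (increasing i j i<j)
... | inj₂ i≡j = ℕ.≤-reflexive (cong (toℕ ∘ p) (toℕ-injective i≡j))

last-in-left-block : {σ : Fin (suc s) → Fin (suc s)} {f : Fin (k + 2) → Fin (k + 2)} {h : Fin 2 → Fin 2} {p : Fin (suc s) → Fin (k + 2)} →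
  (∀ b → f (k ↑ʳ b) ≡ k ↑ʳ h b) → LastUnderTwo σ → IsOccurrence σ f p → toℕ (p (fromℕ s)) ℕ.< k
last-in-left-block {s} {k} {f = f} {h} {p} f-right (a , b , last<a , a<b) (_ , order)
  with ↑ˡ⊎↑ʳ k (p (fromℕ s))
... | inj₁ (c , c↑≡) = subst (ℕ._< k) (trans (sym (toℕ-↑ˡ c 2)) (cong toℕ c↑≡)) (toℕ<n c)
... | inj₂ (c , c↑≡) = ⊥-elim (k≤x<y⇒y≮z {k} k≤value (proj₂ (order _ _) last<a) (proj₂ (order _ _) a<b))
  where
  k≤value : k ≤ toℕ (f (p (fromℕ s)))
  k≤value = subst (k ≤_) (trans (sym (toℕ-↑ʳ k (h c))) (cong toℕ (trans (sym (f-right c)) (cong f c↑≡))))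
              (ℕ.m≤m+n k (toℕ (h c)))

occurrence-in-left-block : {σ : Fin (suc s) → Fin (suc s)} {f : Fin (k + 2) → Fin (k + 2)} {h : Fin 2 → Fin 2} {p : Fin (suc s) → Fin (k + 2)} →
  (∀ b → f (k ↑ʳ b) ≡ k ↑ʳ h b) → LastUnderTwo σ → IsOccurrence σ f p → ∀ i → toℕ (p i) ℕ.< k
occurrence-in-left-block {f = f} {h} f-right σ-last occ@(increasing , _) i =
  ℕ.≤-<-trans (increasing⇒monotone increasing (≤fromℕ i)) (last-in-left-block {f = f} {h} f-right σ-last occ)

occursIn-restriction : {σ : Fin (suc s) → Fin (suc s)} {f : Fin (k + 2) → Fin (k + 2)} {g : Fin k → Fin k} {h : Fin 2 → Fin 2} →
  IsDirectSum f g h → LastUnderTwo σ → OccursIn σ f → OccursIn σ g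
occursIn-restriction {k = k} {f = f} {g} {h} (f-left , f-right) σ-last (p , occ) =
  q , to (isOccurrence-transfer {f = f} {g} (_↑ˡ 2) (↑ˡ-<⇔ 2) f-left p≗q↑ˡ) occ
  where
  in-left-block : ∀ i → toℕ (p i) ℕ.< k
  in-left-block = occurrence-in-left-block {f = f} {h} f-right σ-last occ
  q : _ → Fin k
  q i = fromℕ< (in-left-block i)
  p≗q↑ˡ : ∀ i → p i ≡ q i ↑ˡ 2
  p≗q↑ˡ i = sym (splitAt⁻¹-↑ˡ (splitAt-< k (p i) (in-left-block i)))

avoidance-⇔ : {π : Permutation′ (k + 2)} {σ : Permutation′ k} {h : Fin 2 → Fin 2} →
  IsDirectSum (π ⟨$⟩ʳ_) (σ ⟨$⟩ʳ_) h →
  (Avoids p231 π × Avoids p1432 π × Avoids p231 (square π)) ⇔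
  (Avoids p231 σ × Avoids p1432 σ × Avoids p231 (square σ))
avoidance-⇔ π-sum = mk⇔
  (λ (π-231 , π-1432 , π²-231) →
    π-231 ∘ occursIn-extension π-sum ,
    π-1432 ∘ occursIn-extension π-sum ,
    π²-231 ∘ occursIn-extension π²-sum)
  (λ (σ-231 , σ-1432 , σ²-231) →
    σ-231 ∘ occursIn-restriction π-sum p231-lastUnderTwo ,
    σ-1432 ∘ occursIn-restriction π-sum p1432-lastUnderTwo ,
    σ²-231 ∘ occursIn-restriction π²-sum p231-lastUnderTwo)
  where
  π²-sum = isDirectSum-∘ π-sum π-sum

p21-involutive : ∀ b → p21 (p21 b) ≡ b
p21-involutive zero = refl
p21-involutive (suc zero) = refl

lemma2p5 : (k : ℕ) → 1 ≤ k → (π : Permutation′ (k + 2)) →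
    ((Avoids p231 π × Avoids p1432 π × Avoids p231 (square π)
    × (π ⟨$⟩ʳ (k ↑ʳ zero)) ≡ (k ↑ʳ suc zero)
    × (π ⟨$⟩ʳ (k ↑ʳ suc zero)) ≡ (k ↑ʳ zero))
    ⇔
    Σ (Permutation′ k) λ σ →
    (∀ i → (π ⟨$⟩ʳ i) ≡ ((σ ⟨$⟩ʳ_) ⊕ p21) i)
    × Avoids p231 σ × Avoids p1432 σ × Avoids p231 (square σ))
lemma2p5 k _ π = mk⇔
  (λ (π-231 , π-1432 , π²-231 , π-last₀ , π-last₁) →
    let (σ , π-sum) = restrictˡ π p21 (λ b → p21 b , p21-involutive b)
                        λ { zero → π-last₀ ; (suc zero) → π-last₁ }
    in σ , from ≗⊕⇔isDirectSum π-sum , to (avoidance-⇔ {π = π} {σ} π-sum) (π-231 , π-1432 , π²-231))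
  (λ (σ , π≗σ⊕21 , σ-avoids) →
    let π-sum = to ≗⊕⇔isDirectSum π≗σ⊕21
        (π-231 , π-1432 , π²-231) = from (avoidance-⇔ {π = π} {σ} π-sum) σ-avoids
    in π-231 , π-1432 , π²-231 , on-right π-sum zero , on-right π-sum (suc zero))
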